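{- Let $G$ be a directed acyclic multigraph with single source $s$ and single sink $t$, and let $f$ be a non-negative integer flow on $G$. Let $g$ be an optimal solution of the problem: minimize $\mathrm{val}(g)$ over integer flows $g$ on $G$ with $0\le g\le f$ and $g(e)>0$ for every edge $e$ with $f(e)$ odd. Then $\mathrm{val}(g)\le\mathrm{fwidth}(G,f)$.
   Context: A flow is $g:E(G)\to\mathbb{Z}$ with conservation at vertices other than $s,t$; $\mathrm{val}(g)$ is the total flow leaving $s$; inequalities between flows are pointwise on edges. The flow-width $\mathrm{fwidth}(G,f)$ is the smallest number of $s$-$t$ paths such that every edge with $f(e)>0$ lies on at least one path and every edge $e$ lies on at most $f(e)$ paths. -}

module Defs where

open import Data.Nat using (ℕ; zero; suc)
open import Data.Nat.DivMod using (_%_)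
open import Data.Fin using (Fin; zero; suc; _≟_)
open import Data.Bool using (Bool; true; false; if_then_else_; _∨_; T)
open import Data.Integer using (ℤ; +_; 0ℤ; _+_; _≤_; _<_; ∣_∣)
open import Data.Product using (Σ; Σ-syntax; ∃-syntax; _×_)
open import Data.Empty using (⊥)
open import Relation.Nullary using (¬_)
open import Relation.Nullary.Decidable using (⌊_⌋)
open import Relation.Binary.PropositionalEquality using (_≡_; _≢_)

sumℤ : ∀ {m} → (Fin m → ℤ) → ℤ
sumℤ {zero}  f = 0ℤ
sumℤ {suc m} f = f zero + sumℤ (λ i → f (suc i))

countFin : ∀ {k} → (Fin k → Bool) → ℕ
countFin {zero}  p = 0
countFin {suc k} p = (if p zero then 1 else 0) Data.Nat.+ countFin (λ i → p (suc i))

record Multigraph : Set where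
  field
    V   : ℕ
    E   : ℕ
    src : Fin E → Fin V
    tgt : Fin E → Fin V

module _ (G : Multigraph) where
  open Multigraph G

  data Walk : Fin V → Fin V → Set where
    []  : ∀ {v} → Walk v v
    _∷_ : ∀ {w} (e : Fin E) → Walk (tgt e) w → Walk (src e) w

  -- No directed cycle: no nonempty closed walk.
  Acyclic : Set
  Acyclic = ∀ (e : Fin E) → Walk (tgt e) (src e) → ⊥

  SingleSource : Fin V → Set
  SingleSource s = ∀ v → ((∀ e → tgt e ≢ v) → v ≡ s) × (v ≡ s → ∀ e → tgt e ≢ v)

  SingleSink : Fin V → Set
  SingleSink t = ∀ v → ((∀ e → src e ≢ v) → v ≡ t) × (v ≡ t → ∀ e → src e ≢ v)

  inflow : (Fin E → ℤ) → Fin V → ℤ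
  inflow g v = sumℤ (λ e → if ⌊ tgt e ≟ v ⌋ then g e else 0ℤ)

  outflow : (Fin E → ℤ) → Fin V → ℤ
  outflow g v = sumℤ (λ e → if ⌊ src e ≟ v ⌋ then g e else 0ℤ)

  IsFlow : Fin V → Fin V → (Fin E → ℤ) → Set
  IsFlow s t g = ∀ v → v ≢ s → v ≢ t → inflow g v ≡ outflow g v

  val : Fin V → (Fin E → ℤ) → ℤ
  val s g = outflow g s

  Feasible : Fin V → Fin V → (f g : Fin E → ℤ) → Set
  Feasible s t f g =
    IsFlow s t g
    × (∀ e → 0ℤ ≤ g e)
    × (∀ e → g e ≤ f e)
    × (∀ e → ∣ f e ∣ % 2 ≡ 1 → 0ℤ < g e)

  onWalk : ∀ {u w} → Fin E → Walk u w → Bool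
  onWalk e []       = false
  onWalk e (e′ ∷ p) = ⌊ e ≟ e′ ⌋ ∨ onWalk e p

  IsCover : (s t : Fin V) → (Fin E → ℤ) → (k : ℕ) → (Fin k → Walk s t) → Set
  IsCover s t f k P =
    (∀ e → 0ℤ < f e → ∃[ i ] T (onWalk e (P i)))
    × (∀ e → + countFin (λ i → onWalk e (P i)) ≤ f e)

  HasCover : Fin V → Fin V → (Fin E → ℤ) → ℕ → Set
  HasCover s t f k = Σ[ P ∈ (Fin k → Walk s t) ] IsCover s t f k P

  IsFwidth : Fin V → Fin V → (Fin E → ℤ) → ℕ → Set
  IsFwidth s t f k = HasCover s t f k × (∀ j → HasCover s t f j → k Data.Nat.≤ j)

{-# OPTIONS --safe #-}
module Submission where

-- A minimum cover P₁, …, P_k of f by s-t paths is itself a feasible solution once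
-- superposed: h = Σᵢ 𝟙_{Pᵢ} is a flow (each path indicator is one), h(e) counts the
-- paths through e, so 0 ≤ h ≤ f, and an edge of odd f-value has f(e) > 0, hence is
-- covered and h(e) > 0. As s has no incoming edges, every path leaves s exactly once,
-- so val h ≤ k, and optimality of g gives val g ≤ val h ≤ k. Acyclicity is what makes
-- the edge multiplicities of a path 0/1, i.e. equal to its indicator.

open import Defs
open import Data.Bool using (Bool; true; false; if_then_else_; _∨_; T)
open import Data.Empty using (⊥-elim)
open import Data.Fin using (Fin; zero; suc; _≟_; punchIn)
open import Data.Fin.Properties using (punchInᵢ≢i)
open import Data.Integer using (ℤ; +_; 0ℤ; 1ℤ; _+_; _≤_; _<_; +≤+; +<+; ∣_∣)
open import Data.Integer.Properties
  using (module ≤-Reasoning; +-0-commutativeMonoid; +-identityˡ; +-identityʳ; +-assoc; +-comm;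
         +-monoʳ-≤; +-mono-≤; pos-+; ≤-refl; ≤-trans; ≤-reflexive; ≤∧≢⇒<)
open import Data.Nat as ℕ using (ℕ; zero; suc; z≤n; s≤s)
open import Data.Nat.DivMod using (_%_)
open import Data.Product using (_,_; _×_; proj₂)
open import Data.Unit using (tt)
open import Function using (_∘_)
open import Relation.Nullary using (¬_; Dec; yes; no)
open import Relation.Nullary.Decidable using (⌊_⌋; toWitness)
open import Relation.Binary.PropositionalEquality
open import Algebra.Properties.CommutativeMonoid.Sum +-0-commutativeMonoid
  using (sum; sum-syntax; sum-cong-≗; sum-replicate-zero; sum-remove; ∑-distrib-+; ∑-comm)

𝟙 : Bool → ℤ
𝟙 b = if b then 1ℤ else 0ℤ

0≤𝟙 : ∀ b → 0ℤ ≤ 𝟙 b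
0≤𝟙 true  = +≤+ z≤n
0≤𝟙 false = +≤+ z≤n

𝟙-disjoint-∨ : ∀ a b → ¬ (T a × T b) → 𝟙 a + 𝟙 b ≡ 𝟙 (a ∨ b)
𝟙-disjoint-∨ true  true  ¬both = ⊥-elim (¬both (tt , tt))
𝟙-disjoint-∨ true  false _     = refl
𝟙-disjoint-∨ false true  _     = refl
𝟙-disjoint-∨ false false _     = refl

⌊⌋-false : ∀ {a} {A : Set a} (a? : Dec A) → ¬ A → ⌊ a? ⌋ ≡ false
⌊⌋-false (yes a) ¬a = ⊥-elim (¬a a)
⌊⌋-false (no _)  _  = refl

⌊⌋-true : ∀ {a} {A : Set a} (a? : Dec A) → A → ⌊ a? ⌋ ≡ true
⌊⌋-true (yes _) _ = refl
⌊⌋-true (no ¬a) a = ⊥-elim (¬a a)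

δ : ∀ {m} → Fin m → Fin m → ℤ
δ i j = 𝟙 ⌊ j ≟ i ⌋

odd⇒≢0 : ∀ {x} → ∣ x ∣ % 2 ≡ 1 → x ≢ 0ℤ
odd⇒≢0 () refl

sumℤ≡∑ : ∀ {m} (f : Fin m → ℤ) → sumℤ f ≡ ∑[ i < m ] f i
sumℤ≡∑ {zero}  f = refl
sumℤ≡∑ {suc m} f = cong (_+_ (f zero)) (sumℤ≡∑ (f ∘ suc))

∑-zero : ∀ {m} (f : Fin m → ℤ) → (∀ i → f i ≡ 0ℤ) → ∑[ i < m ] f i ≡ 0ℤ
∑-zero {m} f f≡0 = trans (sum-cong-≗ f≡0) (sum-replicate-zero m)

∑-supported-at : ∀ {m} (f : Fin m → ℤ) (i : Fin m) → (∀ j → j ≢ i → f j ≡ 0ℤ) →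
                 ∑[ j < m ] f j ≡ f i
∑-supported-at {suc m} f i f≡0 = begin
  sum f                                ≡⟨ sum-remove f ⟩
  f i + ∑[ j < m ] f (punchIn i j)     ≡⟨ cong (_+_ (f i)) (∑-zero _ (λ j → f≡0 _ (punchInᵢ≢i i j))) ⟩
  f i + 0ℤ                             ≡⟨ +-identityʳ (f i) ⟩
  f i                                  ∎
  where open ≡-Reasoning

∑-≤-card : ∀ {k} (f : Fin k → ℤ) → (∀ i → f i ≤ 1ℤ) → ∑[ i < k ] f i ≤ + k
∑-≤-card {zero}  f f≤1 = ≤-refl
∑-≤-card {suc k} f f≤1 =
  ≤-trans (+-mono-≤ (f≤1 zero) (∑-≤-card (f ∘ suc) (f≤1 ∘ suc))) (≤-reflexive (sym (pos-+ 1 k)))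

countFin≡∑𝟙 : ∀ {k} (p : Fin k → Bool) → + countFin p ≡ ∑[ i < k ] 𝟙 (p i)
countFin≡∑𝟙 {zero}  p = refl
countFin≡∑𝟙 {suc k} p with p zero
... | true  = trans (pos-+ 1 (countFin (p ∘ suc))) (cong (_+_ 1ℤ) (countFin≡∑𝟙 (p ∘ suc)))
... | false = trans (countFin≡∑𝟙 (p ∘ suc)) (sym (+-identityˡ _))

countFin-pos : ∀ {k} (p : Fin k → Bool) (i : Fin k) → T (p i) → 0 ℕ.< countFin p
countFin-pos p zero    pᵢ with p zero
... | true = s≤s z≤n
countFin-pos p (suc i) pᵢ with p zero
... | true  = s≤s z≤n
... | false = countFin-pos (p ∘ suc) i pᵢ

sumOver : ∀ {m} → (Fin m → Bool) → (Fin m → ℤ) → ℤ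
sumOver b f = sumℤ (λ i → if b i then f i else 0ℤ)

sumOver-none : ∀ {m} (b : Fin m → Bool) (f : Fin m → ℤ) → (∀ i → b i ≡ false) → sumOver b f ≡ 0ℤ
sumOver-none b f b≡false =
  trans (sumℤ≡∑ f′) (∑-zero f′ (λ i → cong (λ c → if c then f i else 0ℤ) (b≡false i)))
  where
  f′ = λ i → if b i then f i else 0ℤ

sumOver-zero : ∀ {m} (b : Fin m → Bool) → sumOver b (λ _ → 0ℤ) ≡ 0ℤ
sumOver-zero b = trans (sumℤ≡∑ zero′) (∑-zero zero′ (if-zero ∘ b))
  where
  zero′ = λ i → if b i then 0ℤ else 0ℤ
  if-zero : ∀ c → (if c then 0ℤ else 0ℤ) ≡ 0ℤ
  if-zero true  = refl
  if-zero false = refl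

sumOver-+ : ∀ {m} (b : Fin m → Bool) (f g : Fin m → ℤ) →
            sumOver b (λ i → f i + g i) ≡ sumOver b f + sumOver b g
sumOver-+ {m} b f g = begin
  sumOver b (λ i → f i + g i)                ≡⟨ sumℤ≡∑ (λ i → if b i then f i + g i else 0ℤ) ⟩
  ∑[ i < m ] (if b i then f i + g i else 0ℤ) ≡⟨ sum-cong-≗ (λ i → if-+ (b i)) ⟩
  ∑[ i < m ] (f′ i + g′ i)                   ≡⟨ ∑-distrib-+ f′ g′ ⟩
  ∑[ i < m ] f′ i + ∑[ i < m ] g′ i          ≡⟨ sym (cong₂ _+_ (sumℤ≡∑ f′) (sumℤ≡∑ g′)) ⟩
  sumOver b f + sumOver b g                  ∎
  where
  open ≡-Reasoning
  f′ g′ : Fin m → ℤ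
  f′ i = if b i then f i else 0ℤ
  g′ i = if b i then g i else 0ℤ
  if-+ : ∀ {x y} c → (if c then x + y else 0ℤ) ≡ (if c then x else 0ℤ) + (if c then y else 0ℤ)
  if-+ true  = refl
  if-+ false = refl

sumOver-∑ : ∀ {m k} (b : Fin m → Bool) (F : Fin k → Fin m → ℤ) →
            sumOver b (λ e → ∑[ i < k ] F i e) ≡ ∑[ i < k ] sumOver b (F i)
sumOver-∑ {m} {k} b F = begin
  sumOver b (λ e → ∑[ i < k ] F i e)                ≡⟨ sumℤ≡∑ (λ e → if b e then ∑[ i < k ] F i e else 0ℤ) ⟩
  ∑[ e < m ] (if b e then ∑[ i < k ] F i e else 0ℤ) ≡⟨ sum-cong-≗ (λ e → if-∑ (b e) (λ i → F i e)) ⟩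
  ∑[ e < m ] ∑[ i < k ] F′ i e                      ≡⟨ ∑-comm (λ e i → F′ i e) ⟩
  ∑[ i < k ] ∑[ e < m ] F′ i e                      ≡⟨ sym (sum-cong-≗ (λ i → sumℤ≡∑ (F′ i))) ⟩
  ∑[ i < k ] sumOver b (F i)                        ∎
  where
  open ≡-Reasoning
  F′ : Fin k → Fin m → ℤ
  F′ i e = if b e then F i e else 0ℤ
  if-∑ : ∀ c (x : Fin k → ℤ) →
         (if c then ∑[ i < k ] x i else 0ℤ) ≡ ∑[ i < k ] (if c then x i else 0ℤ)
  if-∑ true  x = refl
  if-∑ false x = sym (sum-replicate-zero k)

sumOver-δ : ∀ {m} (b : Fin m → Bool) (i : Fin m) → sumOver b (δ i) ≡ 𝟙 (b i)
sumOver-δ {m} b i = begin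
  sumOver b (δ i)          ≡⟨ sumℤ≡∑ f ⟩
  ∑[ j < m ] f j           ≡⟨ ∑-supported-at f i (λ j j≢i → off-i (b j) j≢i) ⟩
  f i                      ≡⟨ at-i (b i) ⟩
  𝟙 (b i)                  ∎
  where
  open ≡-Reasoning
  f : Fin m → ℤ
  f j = if b j then δ i j else 0ℤ
  off-i : ∀ {j} c → j ≢ i → (if c then δ i j else 0ℤ) ≡ 0ℤ
  off-i {j} true  j≢i = cong 𝟙 (⌊⌋-false (j ≟ i) j≢i)
  off-i     false _   = refl
  at-i : ∀ c → (if c then δ i i else 0ℤ) ≡ 𝟙 c
  at-i true  = cong 𝟙 (⌊⌋-true (i ≟ i) refl)
  at-i false = refl

module _ (G : Multigraph) where
  open Multigraph G

  -- inflow G g v and outflow G g v are definitionally sumOver (enters v) g and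
  -- sumOver (leaves v) g, so the sumOver lemmas apply to them without rewriting.
  enters leaves : Fin V → Fin E → Bool
  enters v e = ⌊ tgt e ≟ v ⌋
  leaves v e = ⌊ src e ≟ v ⌋

  multiplicity : ∀ {u w} → Walk G u w → Fin E → ℤ
  multiplicity []       e = 0ℤ
  multiplicity (e′ ∷ p) e = δ e′ e + multiplicity p e

  sumOver-multiplicity-∷ : ∀ (b : Fin E → Bool) {w} e (p : Walk G (tgt e) w) →
                           sumOver b (multiplicity (e ∷ p)) ≡ 𝟙 (b e) + sumOver b (multiplicity p)
  sumOver-multiplicity-∷ b e p =
    trans (sumOver-+ b (δ e) (multiplicity p))
          (cong (_+ sumOver b (multiplicity p)) (sumOver-δ b e))

  walk-conservation : ∀ {u w} (p : Walk G u w) v →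
                      inflow G (multiplicity p) v + 𝟙 ⌊ u ≟ v ⌋
                        ≡ outflow G (multiplicity p) v + 𝟙 ⌊ w ≟ v ⌋
  walk-conservation [] v =
    cong (_+ 𝟙 ⌊ _ ≟ v ⌋) (trans (sumOver-zero (enters v)) (sym (sumOver-zero (leaves v))))
  walk-conservation {w = w} (e ∷ p) v = begin
    inflow G (multiplicity (e ∷ p)) v + out-e
      ≡⟨ cong (_+ out-e) (sumOver-multiplicity-∷ (enters v) e p) ⟩
    (in-e + in-p) + out-e
      ≡⟨ trans (+-comm _ out-e) (cong (_+_ out-e) (+-comm in-e in-p)) ⟩
    out-e + (in-p + in-e)
      ≡⟨ cong (_+_ out-e) (walk-conservation p v) ⟩
    out-e + (out-p + end)
      ≡⟨ +-assoc out-e out-p end ⟨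
    (out-e + out-p) + end
      ≡⟨ cong (_+ end) (sumOver-multiplicity-∷ (leaves v) e p) ⟨
    outflow G (multiplicity (e ∷ p)) v + end
      ∎
    where
    open ≡-Reasoning
    in-e  = 𝟙 (enters v e)
    out-e = 𝟙 (leaves v e)
    in-p  = inflow G (multiplicity p) v
    out-p = outflow G (multiplicity p) v
    end   = 𝟙 ⌊ w ≟ v ⌋

  walk-isFlow : ∀ {s t} (p : Walk G s t) → IsFlow G s t (multiplicity p)
  walk-isFlow {s} {t} p v v≢s v≢t = begin
    in-p                 ≡⟨ +-identityʳ in-p ⟨
    in-p + 0ℤ            ≡⟨ cong (λ x → in-p + 𝟙 x) (⌊⌋-false (s ≟ v) (v≢s ∘ sym)) ⟨
    in-p + 𝟙 ⌊ s ≟ v ⌋   ≡⟨ walk-conservation p v ⟩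
    out-p + 𝟙 ⌊ t ≟ v ⌋  ≡⟨ cong (λ x → out-p + 𝟙 x) (⌊⌋-false (t ≟ v) (v≢t ∘ sym)) ⟩
    out-p + 0ℤ           ≡⟨ +-identityʳ out-p ⟩
    out-p                ∎
    where
    open ≡-Reasoning
    in-p  = inflow G (multiplicity p) v
    out-p = outflow G (multiplicity p) v

  source-inflow : ∀ {s} → SingleSource G s → ∀ g → inflow G g s ≡ 0ℤ
  source-inflow {s} source g =
    sumOver-none (enters s) g (λ e → ⌊⌋-false (tgt e ≟ s) (proj₂ (source s) refl e))

  walk-val≤1 : ∀ {s t} → SingleSource G s → (p : Walk G s t) → val G s (multiplicity p) ≤ 1ℤ
  walk-val≤1 {s} {t} source p = begin
    out-p                ≡⟨ +-identityʳ out-p ⟨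
    out-p + 0ℤ           ≤⟨ +-monoʳ-≤ out-p (0≤𝟙 ⌊ t ≟ s ⌋) ⟩
    out-p + 𝟙 ⌊ t ≟ s ⌋  ≡⟨ walk-conservation p s ⟨
    inflow G (multiplicity p) s + 𝟙 ⌊ s ≟ s ⌋
      ≡⟨ cong₂ _+_ (source-inflow source (multiplicity p)) (cong 𝟙 (⌊⌋-true (s ≟ s) refl)) ⟩
    1ℤ                   ∎
    where
    open ≤-Reasoning
    out-p = outflow G (multiplicity p) s

  prefixUntil : ∀ {x w} e (p : Walk G x w) → T (onWalk G e p) → Walk G x (src e)
  prefixUntil e (e′ ∷ p) on with e ≟ e′
  ... | yes refl = []
  ... | no _     = e′ ∷ prefixUntil e p on

  acyclic⇒not-revisited : Acyclic G → ∀ {w} e (p : Walk G (tgt e) w) → ¬ T (onWalk G e p)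
  acyclic⇒not-revisited acyclic e p on = acyclic e (prefixUntil e p on)

  multiplicity-acyclic : Acyclic G → ∀ {u w} (p : Walk G u w) e →
                         multiplicity p e ≡ 𝟙 (onWalk G e p)
  multiplicity-acyclic acyclic []       e = refl
  multiplicity-acyclic acyclic (e′ ∷ p) e =
    trans (cong (_+_ (δ e′ e)) (multiplicity-acyclic acyclic p e))
          (𝟙-disjoint-∨ ⌊ e ≟ e′ ⌋ (onWalk G e p) disjoint)
    where
    disjoint : ¬ (T ⌊ e ≟ e′ ⌋ × T (onWalk G e p))
    disjoint (hit , on) with refl ← toWitness hit = acyclic⇒not-revisited acyclic e p on

  ∑-isFlow : ∀ {s t k} (F : Fin k → Fin E → ℤ) →
             (∀ i → IsFlow G s t (F i)) → IsFlow G s t (λ e → ∑[ i < k ] F i e)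
  ∑-isFlow F flows v v≢s v≢t =
    trans (sumOver-∑ (enters v) F)
          (trans (sum-cong-≗ (λ i → flows i v v≢s v≢t)) (sym (sumOver-∑ (leaves v) F)))

  pathSum : ∀ {s t k} → (Fin k → Walk G s t) → Fin E → ℤ
  pathSum {k = k} P e = ∑[ i < k ] multiplicity (P i) e

  pathSum-acyclic : Acyclic G → ∀ {s t k} (P : Fin k → Walk G s t) e →
                    pathSum P e ≡ + countFin (λ i → onWalk G e (P i))
  pathSum-acyclic acyclic P e =
    trans (sum-cong-≗ (λ i → multiplicity-acyclic acyclic (P i) e))
          (sym (countFin≡∑𝟙 (λ i → onWalk G e (P i))))

  cover-feasible : Acyclic G → ∀ {s t k f} (P : Fin k → Walk G s t) →
                   IsCover G s t f k P → Feasible G s t f (pathSum P)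
  cover-feasible acyclic {f = f} P (covered , bounded) =
    ∑-isFlow (multiplicity ∘ P) (walk-isFlow ∘ P) , 0≤pathSum , pathSum≤f , odd⇒pathSum>0
    where
    count≡pathSum : ∀ e → + countFin (λ i → onWalk G e (P i)) ≡ pathSum P e
    count≡pathSum e = sym (pathSum-acyclic acyclic P e)
    0≤pathSum : ∀ e → 0ℤ ≤ pathSum P e
    0≤pathSum e = subst (0ℤ ≤_) (count≡pathSum e) (+≤+ z≤n)
    pathSum≤f : ∀ e → pathSum P e ≤ f e
    pathSum≤f e = subst (_≤ f e) (count≡pathSum e) (bounded e)
    odd⇒pathSum>0 : ∀ e → ∣ f e ∣ % 2 ≡ 1 → 0ℤ < pathSum P e
    odd⇒pathSum>0 e odd with covered e (≤∧≢⇒< (≤-trans (0≤pathSum e) (pathSum≤f e)) (odd⇒≢0 odd ∘ sym))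
    ... | i , on = subst (0ℤ <_) (count≡pathSum e) (+<+ (countFin-pos (λ j → onWalk G e (P j)) i on))

  pathSum-val≤ : ∀ {s t k} → SingleSource G s → (P : Fin k → Walk G s t) → val G s (pathSum P) ≤ + k
  pathSum-val≤ {s} source P =
    ≤-trans (≤-reflexive (sumOver-∑ (leaves s) (multiplicity ∘ P)))
            (∑-≤-card _ (λ i → walk-val≤1 source (P i)))

lemma17 : (G : Multigraph) (s t : Fin (Multigraph.V G))
    → Acyclic G → SingleSource G s → SingleSink G t
    → (f : Fin (Multigraph.E G) → ℤ) → IsFlow G s t f → (∀ e → 0ℤ ≤ f e)
    → (g : Fin (Multigraph.E G) → ℤ) → Feasible G s t f g
    → (∀ h → Feasible G s t f h → val G s g ≤ val G s h)
    → (k : ℕ) → IsFwidth G s t f k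
    → val G s g ≤ + k
lemma17 G s t acyclic source _ _ _ _ _ _ optimal k ((P , cover) , _) =
  ≤-trans (optimal (pathSum G P) (cover-feasible G acyclic P cover)) (pathSum-val≤ G source P)
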